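{- Let $m\ge1$ and $l\ge1$ be integers and $j\in\{1,\dots,m\}$. Then there exists a positive integer $D_{m,l}=\prod_{p\le \frac{m+1}{2},\ p \text{ prime}}p^{\nu_p}$ with \[ \nu_p\geq \left( \left\lfloor \frac{j}{p}\right\rfloor +\left\lfloor \frac{m-j}{p}\right\rfloor \right) v_p((l-1)!) \] for each such prime $p$, such that $D_{m,l}^{ -1} B^*_{k,j}(t) \in \mathbb Z[t]$ for all $k=0,1, \ldots ,m$.
   Context: $v_p$ denotes the $p$-adic valuation. For $k\in\{0,\dots,m\}$ let $l^{(k)}_i=l$ for $i\ne k$ and $l^{(k)}_k=l-1$ ($i=0,\dots,m$), and $L=(m+1)l-1$. For $j\in\{0,\dots,m\}$ define $\sigma^{(k,j)}_i$ by $\prod_{i=0}^m(i-j-w)^{l^{(k)}_i}=\sum_{i=0}^L\sigma^{(k,j)}_i w^i$ and \[ B^*_{k,j}(t)=\frac{1}{(l-1)!}\sum_{i=0}^{L} i!\,\sigma^{(k,j)}_i\,t^{L-i}. \] -}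

module Defs where

open import Data.Nat as ℕ using (ℕ; zero; suc; _≤_; _≤?_; _≟_)
open import Data.Nat.Divisibility using (_∣?_)
open import Data.Nat.DivMod using (_/_)
open import Data.Nat.Primality using (Prime; prime?)
open import Data.Integer as ℤ using (ℤ; +_; -_)
open import Data.List using (List; []; _∷_; upTo; filter; map)
open import Data.Nat.ListAction using (product)
open import Data.Bool using (if_then_else_)
open import Relation.Nullary using (yes; no; does)
open import Relation.Nullary.Decidable using (_×-dec_)

-- Polynomials over ℤ as coefficient lists (constant term first).
Poly : Set
Poly = List ℤ

addP : Poly → Poly → Poly
addP [] q = q
addP p [] = p
addP (a ∷ p) (b ∷ q) = (a ℤ.+ b) ∷ addP p q

scaleP : ℤ → Poly → Poly
scaleP c [] = []
scaleP c (a ∷ p) = (c ℤ.* a) ∷ scaleP c p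

mulP : Poly → Poly → Poly
mulP [] q = []
mulP (a ∷ p) q = addP (scaleP a q) (+ 0 ∷ mulP p q)

powP : Poly → ℕ → Poly
powP p zero = + 1 ∷ []
powP p (suc n) = mulP p (powP p n)

coeff : Poly → ℕ → ℤ
coeff [] i = + 0
coeff (a ∷ p) zero = a
coeff (a ∷ p) (suc i) = coeff p i

prodP : ℕ → (ℕ → Poly) → Poly
prodP zero f = f 0
prodP (suc n) f = mulP (prodP n f) (f (suc n))

linP : ℤ → Poly
linP c = c ∷ (- + 1) ∷ []

lk : ℕ → ℕ → ℕ → ℕ
lk l k i = if does (i ≟ k) then l ℕ.∸ 1 else l

σ : (m l k j : ℕ) → ℕ → ℤ
σ m l k j = coeff (prodP m (λ i → powP (linP (+ i ℤ.- + j)) (lk l k i)))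

Lmax : ℕ → ℕ → ℕ
Lmax m l = suc m ℕ.* l ℕ.∸ 1

-- p-adic valuation v_p(n) (with fuel n; v_p(0) := 0, irrelevant here)
vAux : ℕ → ℕ → ℕ → ℕ
vAux zero p n = 0
vAux (suc f) p zero = 0
vAux (suc f) zero (suc n) = 0
vAux (suc f) (suc zero) (suc n) = 0
vAux (suc f) (suc (suc q)) (suc n) with suc (suc q) ∣? suc n
... | yes _ = suc (vAux f (suc (suc q)) (suc n / suc (suc q)))
... | no _ = 0

v : ℕ → ℕ → ℕ
v p n = vAux n p n

-- ∏_{p prime, p ≤ (m+1)/2} p^{ν p}   (p ≤ (m+1)/2 ⇔ 2p ≤ m+1)
primeProd : ℕ → (ℕ → ℕ) → ℕ
primeProd m ν =
  product (map (λ p → p ℕ.^ ν p)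
    (filter (λ p → prime? p ×-dec (2 ℕ.* p ≤? suc m)) (upTo (suc (suc m)))))

-- Say that α ∣! P when α divides s! · [wˢ]P for every s, i.e. every coefficient of P in the
-- basis wˢ/s!; the numbers i! · σᵢ are exactly these coefficients of ∏ᵢ (i - j - w)^(l⁽ᵏ⁾ᵢ). This
-- divisibility is multiplicative, since s! · [wˢ](PQ) is a sum of binomial multiples of a! · [wᵃ]P times
-- (s - a)! · [w^(s-a)]Q. For a single factor, s! · [wˢ](c - w)ⁿ = ± n!/(n - s)! · c^(n-s), which is
-- divisible by n! when c = 0, and by p^(v_p(n!)) when p ∣ c because v_p((n - s)!) ≤ n - s. So for a
-- prime p the factor i = j contributes (l - 1)!, each i ≠ j with p ∣ i - j contributes
-- p^(v_p((l - 1)!)), and there are ⌊j/p⌋ + ⌊(m - j)/p⌋ such i. The divisors obtained for the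
-- distinct primes p combine into (l - 1)! · D.
module Submission where

open import Defs

-- A scope of its own, so that ℕ's _∣_ can be opened without clashing with the integer _∣_ below.
module _ where
  open import Data.Bool using (true; false; if_then_else_)
  open import Data.Empty using (⊥-elim)
  open import Data.Integer as ℤ using (ℤ; +_; -_)
  import Data.Integer.Properties as ℤ
  open import Data.Integer.Divisibility.Signed as ℤ using ()
  import Data.Integer.Tactic.RingSolver as ℤ-Ring
  open import Data.List using ([]; _∷_; _++_; map; filter; upTo)
  open import Data.List.Properties using (applyUpTo-∷ʳ; filter-++; map-++)
  open import Data.Nat as ℕ
    using (ℕ; zero; suc; _+_; _*_; _^_; _∸_; _≤_; _<_; _!; NonZero; z≤n; s≤s; _≟_; ∣_-_∣)
  import Data.Nat.Properties as ℕ
  open import Data.Nat.Combinatorics using (k![n∸k]!∣n!)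
  open import Data.Nat.Divisibility
    using (_∣_; _∣?_; divides; 1∣_; _∣0; ∣1⇒≡1; ∣⇒≤; ∣-refl; ∣-reflexive; ∣-trans; ∣m+n∣m⇒∣n;
           m∣m*n; n∣m*n; *-pres-∣; *-monoʳ-∣; *-cancelˡ-∣; m≤n⇒m!∣n!)
  open import Data.Nat.DivMod
    using (_/_; _%_; m≡m%n+[m/n]*n; m%n<n; m/n<m; m/n*n≤m; m*[n/m]≡n; +-distrib-/; m<n⇒m/n≡0;
           m*n/n≡m; m<n⇒m%n≡m; m*n%n≡0; /-congˡ; 0/n≡0)
  open import Data.Nat.Induction using (<-wellFounded)
  open import Data.Nat.ListAction using (product)
  open import Data.Nat.ListAction.Properties using (product-++)
  open import Data.Nat.Primality using (Prime; prime⇒nonZero; prime⇒nonTrivial; euclidsLemma; prime[2])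
  import Data.Nat.Tactic.RingSolver as ℕ-Ring
  open import Data.Product using (Σ; _×_; _,_)
  open import Data.Sum using (_⊎_; inj₁; inj₂)
  open import Function using (_∘_; id)
  open import Induction.WellFounded using (Acc; acc)
  open import Relation.Binary.PropositionalEquality
    using (_≡_; _≢_; refl; sym; trans; cong; cong₂; subst; subst₂; module ≡-Reasoning)
  open import Relation.Nullary using (¬_; Dec; yes; no; does)
  open import Relation.Unary using (Decidable)

  -- Divisibility in the basis wˢ/s!

  coeff-addP : ∀ P Q i → coeff (addP P Q) i ≡ coeff P i ℤ.+ coeff Q i
  coeff-addP []      Q       i       = sym (ℤ.+-identityˡ _)
  coeff-addP (a ∷ P) []      i       = sym (ℤ.+-identityʳ _)
  coeff-addP (a ∷ P) (b ∷ Q) zero    = refl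
  coeff-addP (a ∷ P) (b ∷ Q) (suc i) = coeff-addP P Q i

  coeff-scaleP : ∀ c P i → coeff (scaleP c P) i ≡ c ℤ.* coeff P i
  coeff-scaleP c []      i       = sym (ℤ.*-zeroʳ c)
  coeff-scaleP c (a ∷ P) zero    = refl
  coeff-scaleP c (a ∷ P) (suc i) = coeff-scaleP c P i

  ∑≤ : ℕ → (ℕ → ℤ) → ℤ
  ∑≤ zero    f = f 0
  ∑≤ (suc n) f = f 0 ℤ.+ ∑≤ n (f ∘ suc)

  ∑≤-zero : ∀ n f → (∀ a → f a ≡ + 0) → ∑≤ n f ≡ + 0
  ∑≤-zero zero    f f≡0 = f≡0 0
  ∑≤-zero (suc n) f f≡0 = cong₂ ℤ._+_ (f≡0 0) (∑≤-zero n (f ∘ suc) (f≡0 ∘ suc))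

  *-distribˡ-∑≤ : ∀ c n f → c ℤ.* ∑≤ n f ≡ ∑≤ n (λ a → c ℤ.* f a)
  *-distribˡ-∑≤ c zero    f = refl
  *-distribˡ-∑≤ c (suc n) f =
    trans (ℤ.*-distribˡ-+ c (f 0) _) (cong (λ t → c ℤ.* f 0 ℤ.+ t) (*-distribˡ-∑≤ c n (f ∘ suc)))

  ∣-∑≤ : ∀ d n f → (∀ a → a ≤ n → d ℤ.∣ f a) → d ℤ.∣ ∑≤ n f
  ∣-∑≤ d zero    f d∣f = d∣f 0 z≤n
  ∣-∑≤ d (suc n) f d∣f =
    ℤ.∣m∣n⇒∣m+n (d∣f 0 z≤n) (∣-∑≤ d n (f ∘ suc) (λ a a≤n → d∣f (suc a) (s≤s a≤n)))

  coeff-mulP : ∀ P Q n → coeff (mulP P Q) n ≡ ∑≤ n (λ a → coeff P a ℤ.* coeff Q (n ∸ a))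
  coeff-mulP []      Q n       = sym (∑≤-zero n _ (λ a → ℤ.*-zeroˡ (coeff Q (n ∸ a))))
  coeff-mulP (a ∷ P) Q zero    =
    trans (coeff-addP (scaleP a Q) _ 0) (trans (ℤ.+-identityʳ _) (coeff-scaleP a Q 0))
  coeff-mulP (a ∷ P) Q (suc n) =
    trans (coeff-addP (scaleP a Q) _ (suc n)) (cong₂ ℤ._+_ (coeff-scaleP a Q (suc n)) (coeff-mulP P Q n))

  infix 4 _∣!_
  _∣!_ : ℕ → Poly → Set
  α ∣! P = ∀ s → + α ℤ.∣ + (s !) ℤ.* coeff P s

  *-pres-∣ℤ : ∀ {α β x y} → α ℤ.∣ x → β ℤ.∣ y → α ℤ.* β ℤ.∣ x ℤ.* y
  *-pres-∣ℤ {α} {β} (ℤ.divides q refl) (ℤ.divides r refl) = ℤ.divides (q ℤ.* r) (regroup q α r β)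
    where
    regroup : ∀ q α r β → q ℤ.* α ℤ.* (r ℤ.* β) ≡ q ℤ.* r ℤ.* (α ℤ.* β)
    regroup = ℤ-Ring.solve-∀

  ∣!-mulP : ∀ {α β P Q} → α ∣! P → β ∣! Q → α * β ∣! mulP P Q
  ∣!-mulP {α} {β} {P} {Q} α∣!P β∣!Q s =
    subst₂ ℤ._∣_ (sym (ℤ.pos-* α β)) (sym expand) (∣-∑≤ _ s _ term)
    where
    expand : + (s !) ℤ.* coeff (mulP P Q) s ≡ ∑≤ s (λ a → + (s !) ℤ.* (coeff P a ℤ.* coeff Q (s ∸ a)))
    expand = trans (cong (+ (s !) ℤ.*_) (coeff-mulP P Q s)) (*-distribˡ-∑≤ (+ (s !)) s _)

    regroup : ∀ {n K a b} x y → n ≡ K * (a * b) →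
              + n ℤ.* (x ℤ.* y) ≡ + K ℤ.* ((+ a ℤ.* x) ℤ.* (+ b ℤ.* y))
    regroup {K = K} {a} {b} x y refl = begin
      + (K * (a * b)) ℤ.* (x ℤ.* y)         ≡⟨ cong (ℤ._* (x ℤ.* y)) (ℤ.pos-* K (a * b)) ⟩
      + K ℤ.* + (a * b) ℤ.* (x ℤ.* y)       ≡⟨ cong (λ t → + K ℤ.* t ℤ.* (x ℤ.* y)) (ℤ.pos-* a b) ⟩
      + K ℤ.* (+ a ℤ.* + b) ℤ.* (x ℤ.* y)   ≡⟨ shuffle (+ K) (+ a) (+ b) x y ⟩
      + K ℤ.* ((+ a ℤ.* x) ℤ.* (+ b ℤ.* y)) ∎
      where
      open ≡-Reasoning
      shuffle : ∀ k a b x y → k ℤ.* (a ℤ.* b) ℤ.* (x ℤ.* y) ≡ k ℤ.* ((a ℤ.* x) ℤ.* (b ℤ.* y))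
      shuffle = ℤ-Ring.solve-∀

    term : ∀ a → a ≤ s → + α ℤ.* + β ℤ.∣ + (s !) ℤ.* (coeff P a ℤ.* coeff Q (s ∸ a))
    term a a≤s with k![n∸k]!∣n! a≤s
    ... | divides K s!≡ =
      subst (_ ℤ.∣_) (sym (regroup {K = K} {a !} {(s ∸ a) !} (coeff P a) (coeff Q (s ∸ a)) s!≡))
        (ℤ.∣n⇒∣m*n (+ K) (*-pres-∣ℤ (α∣!P a) (β∣!Q (s ∸ a))))

  ∣!-weaken : ∀ {d α P} → d ∣ α → α ∣! P → d ∣! P
  ∣!-weaken d∣α α∣!P s = ℤ.∣-trans (ℤ.∣ᵤ⇒∣ d∣α) (α∣!P s)

  1∣!P : ∀ P → 1 ∣! P
  1∣!P P s = ℤ.∣ᵤ⇒∣ (1∣ _)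

  ∏≤ : ℕ → (ℕ → ℕ) → ℕ
  ∏≤ zero    w = w 0
  ∏≤ (suc n) w = ∏≤ n w * w (suc n)

  ∣!-prodP : ∀ n {w f} → (∀ i → i ≤ n → w i ∣! f i) → ∏≤ n w ∣! prodP n f
  ∣!-prodP zero    w∣!f = w∣!f 0 z≤n
  ∣!-prodP (suc n) {w} {f} w∣!f = ∣!-mulP {P = prodP n f} {Q = f (suc n)}
    (∣!-prodP n {w} {f} (λ i i≤n → w∣!f i (ℕ.m≤n⇒m≤1+n i≤n))) (w∣!f (suc n) ℕ.≤-refl)

  -- Powers of c - w

  fall : ℕ → ℕ → ℕ
  fall n       zero    = 1
  fall zero    (suc s) = 0
  fall (suc n) (suc s) = suc n * fall n s

  fall-suc : ∀ n s → fall n (suc s) + suc s * fall n s ≡ suc n * fall n s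
  fall-suc zero    zero    = refl
  fall-suc zero    (suc s) = ℕ.*-zeroʳ (suc (suc s))
  fall-suc (suc n) zero    = unit n
    where
    unit : ∀ n → (1 + n) * 1 + 1 * 1 ≡ (2 + n) * 1
    unit = ℕ-Ring.solve-∀
  fall-suc (suc n) (suc s) = begin
    suc n * fall n (suc s) + suc (suc s) * (suc n * fall n s)
      ≡⟨ factor (suc n) (fall n (suc s)) (suc s) (fall n s) ⟩
    suc n * (fall n (suc s) + suc s * fall n s) + suc n * fall n s
      ≡⟨ cong (λ t → suc n * t + suc n * fall n s) (fall-suc n s) ⟩
    suc n * (suc n * fall n s) + suc n * fall n s
      ≡⟨ collect (suc n) (fall n s) ⟩
    suc (suc n) * (suc n * fall n s) ∎
    where
    open ≡-Reasoning
    factor : ∀ a x b y → a * x + (1 + b) * (a * y) ≡ a * (x + b * y) + a * y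
    factor = ℕ-Ring.solve-∀
    collect : ∀ a y → a * (a * y) + a * y ≡ (1 + a) * (a * y)
    collect = ℕ-Ring.solve-∀

  n!≡fall*[n∸s]! : ∀ {n s} → s ≤ n → n ! ≡ fall n s * (n ∸ s) !
  n!≡fall*[n∸s]! {n} {zero}      z≤n       = sym (ℕ.+-identityʳ (n !))
  n!≡fall*[n∸s]! {suc n} {suc s} (s≤s s≤n) =
    trans (cong (suc n *_) (n!≡fall*[n∸s]! s≤n)) (sym (ℕ.*-assoc (suc n) (fall n s) _))

  fall-zero : ∀ {n s} → n < s → fall n s ≡ 0
  fall-zero {zero}  {suc s} _         = refl
  fall-zero {suc n} {suc s} (s≤s n<s) = trans (cong (suc n *_) (fall-zero n<s)) (ℕ.*-zeroʳ (suc n))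

  -1^_ : ℕ → ℤ
  -1^ zero  = + 1
  -1^ suc s = - (-1^ s)

  ∣-1^s∣≡1 : ∀ s → ℤ.∣ -1^ s ∣ ≡ 1
  ∣-1^s∣≡1 zero    = refl
  ∣-1^s∣≡1 (suc s) = trans (ℤ.∣-i∣≡∣i∣ (-1^ s)) (∣-1^s∣≡1 s)

  coeff-linP-mulP-zero : ∀ c Q → coeff (mulP (linP c) Q) 0 ≡ c ℤ.* coeff Q 0
  coeff-linP-mulP-zero c Q = trans (coeff-addP (scaleP c Q) _ 0) (trans (ℤ.+-identityʳ _) (coeff-scaleP c Q 0))

  coeff-linP-mulP-suc : ∀ c Q s → coeff (mulP (linP c) Q) (suc s) ≡ c ℤ.* coeff Q (suc s) ℤ.- coeff Q s
  coeff-linP-mulP-suc c Q s = begin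
    coeff (mulP (linP c) Q) (suc s)
      ≡⟨ coeff-addP (scaleP c Q) _ (suc s) ⟩
    coeff (scaleP c Q) (suc s) ℤ.+ coeff (addP (scaleP (- + 1) Q) (+ 0 ∷ [])) s
      ≡⟨ cong₂ ℤ._+_ (coeff-scaleP c Q (suc s)) (coeff-addP (scaleP (- + 1) Q) _ s) ⟩
    c ℤ.* coeff Q (suc s) ℤ.+ (coeff (scaleP (- + 1) Q) s ℤ.+ coeff (+ 0 ∷ []) s)
      ≡⟨ cong₂ (λ a b → c ℤ.* coeff Q (suc s) ℤ.+ (a ℤ.+ b)) (coeff-scaleP (- + 1) Q s) (coeff-0∷[] s) ⟩
    c ℤ.* coeff Q (suc s) ℤ.+ (- + 1 ℤ.* coeff Q s ℤ.+ + 0)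
      ≡⟨ negate (c ℤ.* coeff Q (suc s)) (coeff Q s) ⟩
    c ℤ.* coeff Q (suc s) ℤ.- coeff Q s ∎
    where
    open ≡-Reasoning
    coeff-0∷[] : ∀ s → coeff (+ 0 ∷ []) s ≡ + 0
    coeff-0∷[] zero    = refl
    coeff-0∷[] (suc s) = refl
    negate : ∀ x y → x ℤ.+ (- + 1 ℤ.* y ℤ.+ + 0) ≡ x ℤ.- y
    negate = ℤ-Ring.solve-∀

  scaledCoeff : ℤ → ℕ → ℕ → ℤ
  scaledCoeff c n s = + fall n s ℤ.* c ℤ.^ (n ∸ s) ℤ.* -1^ s

  scaledCoeff-suc : ∀ c n s →
    c ℤ.* scaledCoeff c n (suc s) ℤ.- + suc s ℤ.* scaledCoeff c n s ≡ scaledCoeff c (suc n) (suc s)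
  scaledCoeff-suc c n s = begin
    c ℤ.* (+ A ℤ.* c ℤ.^ (n ∸ suc s) ℤ.* - ε) ℤ.- + suc s ℤ.* (+ B ℤ.* Z ℤ.* ε)
      ≡⟨ regroup (+ A) c (c ℤ.^ (n ∸ suc s)) (+ suc s) (+ B) Z ε ⟩
    + A ℤ.* (c ℤ.* c ℤ.^ (n ∸ suc s)) ℤ.* - ε ℤ.- + suc s ℤ.* + B ℤ.* Z ℤ.* ε
      ≡⟨ cong (λ t → t ℤ.* - ε ℤ.- + suc s ℤ.* + B ℤ.* Z ℤ.* ε) shift ⟩
    + A ℤ.* Z ℤ.* - ε ℤ.- + suc s ℤ.* + B ℤ.* Z ℤ.* ε
      ≡⟨ collect (+ A) (+ suc s) (+ B) Z ε ⟩
    (+ A ℤ.+ + suc s ℤ.* + B) ℤ.* Z ℤ.* - ε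
      ≡⟨ cong (λ t → t ℤ.* Z ℤ.* - ε) (sym (ℤ-fall-suc)) ⟩
    + (suc n * B) ℤ.* Z ℤ.* - ε ∎
    where
    open ≡-Reasoning
    A = fall n (suc s)
    B = fall n s
    Z = c ℤ.^ (n ∸ s)
    ε = -1^ s
    shift : + A ℤ.* (c ℤ.* c ℤ.^ (n ∸ suc s)) ≡ + A ℤ.* Z
    shift with ℕ.<-≤-connex s n
    ... | inj₁ s<n = cong (λ e → + A ℤ.* c ℤ.^ e) (sym (ℕ.+-∸-assoc 1 s<n))
    ... | inj₂ n≤s rewrite fall-zero (s≤s n≤s) = refl
    ℤ-fall-suc : + (suc n * B) ≡ + A ℤ.+ + suc s ℤ.* + B
    ℤ-fall-suc = trans (cong +_ (sym (fall-suc n s)))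
                   (trans (ℤ.pos-+ A _) (cong (λ t → + A ℤ.+ t) (ℤ.pos-* (suc s) B)))
    regroup : ∀ a c y t b z ε → c ℤ.* (a ℤ.* y ℤ.* - ε) ℤ.- t ℤ.* (b ℤ.* z ℤ.* ε)
                              ≡ a ℤ.* (c ℤ.* y) ℤ.* - ε ℤ.- t ℤ.* b ℤ.* z ℤ.* ε
    regroup = ℤ-Ring.solve-∀
    collect : ∀ a t b z ε → a ℤ.* z ℤ.* - ε ℤ.- t ℤ.* b ℤ.* z ℤ.* ε
                          ≡ (a ℤ.+ t ℤ.* b) ℤ.* z ℤ.* - ε
    collect = ℤ-Ring.solve-∀

  coeff-powP-linP : ∀ c n s → + (s !) ℤ.* coeff (powP (linP c) n) s ≡ scaledCoeff c n s
  coeff-powP-linP c zero    zero    = refl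
  coeff-powP-linP c zero    (suc s) = ℤ.*-zeroʳ (+ (suc s !))
  coeff-powP-linP c (suc n) zero    = begin
    + 1 ℤ.* coeff (mulP (linP c) Q) 0  ≡⟨ cong (+ 1 ℤ.*_) (coeff-linP-mulP-zero c Q) ⟩
    + 1 ℤ.* (c ℤ.* coeff Q 0)          ≡⟨ pull c (coeff Q 0) ⟩
    c ℤ.* (+ 1 ℤ.* coeff Q 0)          ≡⟨ cong (c ℤ.*_) (coeff-powP-linP c n 0) ⟩
    c ℤ.* (+ 1 ℤ.* c ℤ.^ n ℤ.* + 1)    ≡⟨ push c (c ℤ.^ n) ⟩
    + 1 ℤ.* (c ℤ.* c ℤ.^ n) ℤ.* + 1    ∎
    where
    open ≡-Reasoning
    Q = powP (linP c) n
    pull : ∀ c q → + 1 ℤ.* (c ℤ.* q) ≡ c ℤ.* (+ 1 ℤ.* q)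
    pull = ℤ-Ring.solve-∀
    push : ∀ c x → c ℤ.* (+ 1 ℤ.* x ℤ.* + 1) ≡ + 1 ℤ.* (c ℤ.* x) ℤ.* + 1
    push = ℤ-Ring.solve-∀
  coeff-powP-linP c (suc n) (suc s) = begin
    + (suc s !) ℤ.* coeff (mulP (linP c) Q) (suc s)
      ≡⟨ cong (+ (suc s !) ℤ.*_) (coeff-linP-mulP-suc c Q s) ⟩
    + (suc s !) ℤ.* (c ℤ.* Q₁ ℤ.- Q₀)
      ≡⟨ cong (λ t → t ℤ.* (c ℤ.* Q₁ ℤ.- Q₀)) (ℤ.pos-* (suc s) (s !)) ⟩
    + suc s ℤ.* + (s !) ℤ.* (c ℤ.* Q₁ ℤ.- Q₀)
      ≡⟨ distribute (+ suc s) (+ (s !)) c Q₁ Q₀ ⟩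
    c ℤ.* (+ suc s ℤ.* + (s !) ℤ.* Q₁) ℤ.- + suc s ℤ.* (+ (s !) ℤ.* Q₀)
      ≡⟨ cong (λ t → c ℤ.* (t ℤ.* Q₁) ℤ.- + suc s ℤ.* (+ (s !) ℤ.* Q₀)) (ℤ.pos-* (suc s) (s !)) ⟨
    c ℤ.* (+ (suc s !) ℤ.* Q₁) ℤ.- + suc s ℤ.* (+ (s !) ℤ.* Q₀)
      ≡⟨ cong₂ (λ a b → c ℤ.* a ℤ.- + suc s ℤ.* b) (coeff-powP-linP c n (suc s)) (coeff-powP-linP c n s) ⟩
    c ℤ.* scaledCoeff c n (suc s) ℤ.- + suc s ℤ.* scaledCoeff c n s
      ≡⟨ scaledCoeff-suc c n s ⟩
    scaledCoeff c (suc n) (suc s) ∎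
    where
    open ≡-Reasoning
    Q  = powP (linP c) n
    Q₁ = coeff Q (suc s)
    Q₀ = coeff Q s
    distribute : ∀ t f c q₁ q₀ → t ℤ.* f ℤ.* (c ℤ.* q₁ ℤ.- q₀)
                               ≡ c ℤ.* (t ℤ.* f ℤ.* q₁) ℤ.- t ℤ.* (f ℤ.* q₀)
    distribute = ℤ-Ring.solve-∀

  ∣c^n∣≡∣c∣^n : ∀ c n → ℤ.∣ c ℤ.^ n ∣ ≡ ℤ.∣ c ∣ ^ n
  ∣c^n∣≡∣c∣^n c zero    = refl
  ∣c^n∣≡∣c∣^n c (suc n) = trans (ℤ.abs-* c (c ℤ.^ n)) (cong (ℤ.∣ c ∣ *_) (∣c^n∣≡∣c∣^n c n))

  ∣!-powP-linP : ∀ {α} c n → (∀ s → s ≤ n → α ∣ fall n s * ℤ.∣ c ∣ ^ (n ∸ s)) →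
                 α ∣! powP (linP c) n
  ∣!-powP-linP {α} c n α∣ s = subst (+ α ℤ.∣_) (sym (coeff-powP-linP c n s))
    (ℤ.∣ᵤ⇒∣ (subst (α ∣_) (sym ∣coeff∣) (α∣-all (ℕ.≤-<-connex s n))))
    where
    ∣coeff∣ : ℤ.∣ scaledCoeff c n s ∣ ≡ fall n s * ℤ.∣ c ∣ ^ (n ∸ s)
    ∣coeff∣ = begin
      ℤ.∣ + fall n s ℤ.* c ℤ.^ (n ∸ s) ℤ.* -1^ s ∣
        ≡⟨ ℤ.abs-* (+ fall n s ℤ.* c ℤ.^ (n ∸ s)) (-1^ s) ⟩
      ℤ.∣ + fall n s ℤ.* c ℤ.^ (n ∸ s) ∣ * ℤ.∣ -1^ s ∣
        ≡⟨ cong₂ _*_ (ℤ.abs-* (+ fall n s) (c ℤ.^ (n ∸ s))) (∣-1^s∣≡1 s) ⟩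
      fall n s * ℤ.∣ c ℤ.^ (n ∸ s) ∣ * 1
        ≡⟨ ℕ.*-identityʳ _ ⟩
      fall n s * ℤ.∣ c ℤ.^ (n ∸ s) ∣
        ≡⟨ cong (fall n s *_) (∣c^n∣≡∣c∣^n c (n ∸ s)) ⟩
      fall n s * ℤ.∣ c ∣ ^ (n ∸ s) ∎
      where open ≡-Reasoning
    α∣-all : s ≤ n ⊎ n < s → α ∣ fall n s * ℤ.∣ c ∣ ^ (n ∸ s)
    α∣-all (inj₁ s≤n) = α∣ s s≤n
    α∣-all (inj₂ n<s) = subst (λ f → α ∣ f * ℤ.∣ c ∣ ^ (n ∸ s)) (sym (fall-zero n<s)) (α ∣0)

  ∣!-powP-linP-root : ∀ {α} n → α ∣ n ! → α ∣! powP (linP (+ 0)) n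
  ∣!-powP-linP-root {α} n α∣n! = ∣!-powP-linP (+ 0) n α∣
    where
    α∣ : ∀ s → s ≤ n → α ∣ fall n s * 0 ^ (n ∸ s)
    α∣ s s≤n with ℕ.m≤n⇒m<n∨m≡n s≤n
    ... | inj₁ s<n  rewrite ℕ.+-∸-assoc 1 s<n = subst (α ∣_) (sym (ℕ.*-zeroʳ (fall n s))) (α ∣0)
    ... | inj₂ refl rewrite ℕ.n∸n≡0 s =
      subst (α ∣_) (trans (n!≡fall*[n∸s]! s≤n) (cong (λ e → fall s s * e !) (ℕ.n∸n≡0 s))) α∣n!

  ^-monoʳ-∣ : ∀ p {e t} → e ≤ t → p ^ e ∣ p ^ t
  ^-monoʳ-∣ p {e} {t} e≤t =
    divides (p ^ (t ∸ e)) (trans (cong (p ^_) (sym (ℕ.m∸n+n≡m e≤t))) (ℕ.^-distribˡ-+-* p (t ∸ e) e))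

  ^-monoˡ-∣ : ∀ {a b} n → a ∣ b → a ^ n ∣ b ^ n
  ^-monoˡ-∣ zero    a∣b = ∣-refl
  ^-monoˡ-∣ (suc n) a∣b = *-pres-∣ a∣b (^-monoˡ-∣ n a∣b)

  -- The p-part of a factorial

  module _ {p : ℕ} (p-prime : Prime p) where
    private instance
      p≢0 : NonZero p
      p≢0 = prime⇒nonZero p-prime

    1<p : 1 < p
    1<p = ℕ.nonTrivial⇒n>1 p {{prime⇒nonTrivial p-prime}}

    ∤1 : ¬ p ∣ 1
    ∤1 p∣1 = ℕ.<-irrefl (sym (∣1⇒≡1 p∣1)) 1<p

    ∤-* : ∀ {a b} → ¬ p ∣ a → ¬ p ∣ b → ¬ p ∣ a * b
    ∤-* {a} {b} p∤a p∤b p∣ab with euclidsLemma a b p-prime p∣ab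
    ... | inj₁ p∣a = p∤a p∣a
    ... | inj₂ p∣b = p∤b p∣b

    ^∣-cancel-∤ : ∀ {x} a k → ¬ p ∣ x → p ^ a ∣ k * x → p ^ a ∣ k
    ^∣-cancel-∤         zero    k p∤x _ = 1∣ k
    ^∣-cancel-∤ {x} (suc a) k p∤x pᵃ⁺¹∣kx
      with euclidsLemma k x p-prime (∣-trans (m∣m*n (p ^ a)) pᵃ⁺¹∣kx)
    ... | inj₂ p∣x = ⊥-elim (p∤x p∣x)
    ... | inj₁ (divides k′ refl) =
      subst (p * p ^ a ∣_) (ℕ.*-comm p k′)
        (*-monoʳ-∣ p (^∣-cancel-∤ a k′ p∤x (*-cancelˡ-∣ p pᵃ⁺¹∣pk′x)))
      where
      move : ∀ k p x → k * p * x ≡ p * (k * x)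
      move = ℕ-Ring.solve-∀
      pᵃ⁺¹∣pk′x : p * p ^ a ∣ p * (k′ * x)
      pᵃ⁺¹∣pk′x = subst (p * p ^ a ∣_) (move k′ p x) pᵃ⁺¹∣kx

    -- Among 1, …, q * p + r the multiples of p are p * 1, …, p * q, contributing p ^ q * q !.
    [q*p+r]!-split : ∀ q r → r < p → Σ ℕ λ A → ¬ p ∣ A × (q * p + r) ! ≡ A * (p ^ q * q !)
    [q*p+r]!-split zero zero _ = 1 , ∤1 , refl
    [q*p+r]!-split q (suc r) 1+r<p with [q*p+r]!-split q r (ℕ.<-trans (ℕ.n<1+n r) 1+r<p)
    ... | A , p∤A , eq = suc (q * p + r) * A , ∤-* p∤qp+1+r p∤A , step
      where
      p∤qp+1+r : ¬ p ∣ suc (q * p + r)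
      p∤qp+1+r p∣ = ℕ.<-irrefl refl (ℕ.≤-<-trans (∣⇒≤ p∣1+r) 1+r<p)
        where
        p∣1+r : p ∣ suc r
        p∣1+r = ∣m+n∣m⇒∣n (subst (p ∣_) (sym (ℕ.+-suc (q * p) r)) p∣) (n∣m*n q)
      step : (q * p + suc r) ! ≡ suc (q * p + r) * A * (p ^ q * q !)
      step = trans (cong _! (ℕ.+-suc (q * p) r))
               (trans (cong (suc (q * p + r) *_) eq) (sym (ℕ.*-assoc (suc (q * p + r)) A _)))
    [q*p+r]!-split (suc q) zero _ with [q*p+r]!-split q (ℕ.pred p) (ℕ.m≤pred[n]⇒suc[m]≤n ℕ.≤-refl)
    ... | A , p∤A , eq = A , p∤A , (begin
      (suc q * p + 0) !                           ≡⟨ cong _! [1+q]p≡ ⟩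
      suc (q * p + ℕ.pred p) * (q * p + ℕ.pred p) ! ≡⟨ cong₂ _*_ (sym [1+q]p≡) eq ⟩
      (suc q * p + 0) * (A * (p ^ q * q !))        ≡⟨ rearrange q p A (p ^ q) (q !) ⟩
      A * (p * p ^ q * (suc q * q !))              ∎)
      where
      open ≡-Reasoning
      [1+q]p≡ : suc q * p + 0 ≡ suc (q * p + ℕ.pred p)
      [1+q]p≡ = begin
        suc q * p + 0          ≡⟨ ℕ.+-identityʳ (suc q * p) ⟩
        p + q * p              ≡⟨ ℕ.+-comm p (q * p) ⟩
        q * p + p              ≡⟨ cong (λ t → q * p + t) (sym (ℕ.suc-pred p)) ⟩
        q * p + suc (ℕ.pred p) ≡⟨ ℕ.+-suc (q * p) (ℕ.pred p) ⟩
        suc (q * p + ℕ.pred p) ∎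
      rearrange : ∀ q p A P F → ((1 + q) * p + 0) * (A * (P * F)) ≡ A * (p * P * ((1 + q) * F))
      rearrange = ℕ-Ring.solve-∀

    factorial-p-part : ∀ t → Σ ℕ λ e → Σ ℕ λ z → e ≤ t × ¬ p ∣ z × t ! ≡ p ^ e * z
    factorial-p-part t = go t (<-wellFounded t)
      where
      go : ∀ t → Acc _<_ t → Σ ℕ λ e → Σ ℕ λ z → e ≤ t × ¬ p ∣ z × t ! ≡ p ^ e * z
      go zero          _         = 0 , 1 , z≤n , ∤1 , refl
      go t@(suc _) (acc rec)
        with [q*p+r]!-split (t / p) (t % p) (m%n<n t p) | go (t / p) (rec (m/n<m t p 1<p))
      ... | A , p∤A , split | e , z , e≤q , p∤z , q!≡ = q + e , A * z , q+e≤t , ∤-* p∤A p∤z , t!≡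
        where
        q = t / p
        t≡qp+r : t ≡ q * p + t % p
        t≡qp+r = trans (m≡m%n+[m/n]*n t p) (ℕ.+-comm (t % p) (q * p))
        q+e≤t : q + e ≤ t
        q+e≤t = begin
          q + e     ≤⟨ ℕ.+-monoʳ-≤ q e≤q ⟩
          q + q     ≡⟨ double q ⟩
          q * 2     ≤⟨ ℕ.*-monoʳ-≤ q 1<p ⟩
          q * p     ≤⟨ m/n*n≤m t p ⟩
          t         ∎
          where
          open ℕ.≤-Reasoning
          double : ∀ q → q + q ≡ q * 2
          double = ℕ-Ring.solve-∀
        reorder : ∀ A P Q z → A * (P * (Q * z)) ≡ P * Q * (A * z)
        reorder = ℕ-Ring.solve-∀
        t!≡ : t ! ≡ p ^ (q + e) * (A * z)
        t!≡ = begin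
          t !                        ≡⟨ cong _! t≡qp+r ⟩
          (q * p + t % p) !          ≡⟨ split ⟩
          A * (p ^ q * q !)          ≡⟨ cong (λ x → A * (p ^ q * x)) q!≡ ⟩
          A * (p ^ q * (p ^ e * z))  ≡⟨ reorder A (p ^ q) (p ^ e) z ⟩
          p ^ q * p ^ e * (A * z)    ≡⟨ cong (_* (A * z)) (sym (ℕ.^-distribˡ-+-* p q e)) ⟩
          p ^ (q + e) * (A * z)      ∎
          where open ≡-Reasoning

    p^V∣n!⇒p^V∣fall*p^[n∸s] : ∀ {V n s} → s ≤ n → p ^ V ∣ n ! → p ^ V ∣ fall n s * p ^ (n ∸ s)
    p^V∣n!⇒p^V∣fall*p^[n∸s] {V} {n} {s} s≤n p^V∣n! with factorial-p-part (n ∸ s)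
    ... | e , z , e≤n∸s , p∤z , [n∸s]!≡ =
      ∣-trans (^∣-cancel-∤ V (fall n s * p ^ e) p∤z (subst (p ^ V ∣_) n!≡ p^V∣n!))
              (*-monoʳ-∣ (fall n s) (^-monoʳ-∣ p e≤n∸s))
      where
      n!≡ : n ! ≡ fall n s * p ^ e * z
      n!≡ = trans (n!≡fall*[n∸s]! s≤n)
              (trans (cong (fall n s *_) [n∸s]!≡) (sym (ℕ.*-assoc (fall n s) (p ^ e) z)))

    ∣!-powP-linP-prime : ∀ {V} c n → p ∣ ℤ.∣ c ∣ → p ^ V ∣ n ! → p ^ V ∣! powP (linP c) n
    ∣!-powP-linP-prime {V} c n p∣c p^V∣n! = ∣!-powP-linP c n λ s s≤n →
      ∣-trans (p^V∣n!⇒p^V∣fall*p^[n∸s] {V} s≤n p^V∣n!)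
              (*-monoʳ-∣ (fall n s) (^-monoˡ-∣ (n ∸ s) p∣c))

  p^vAux∣ : ∀ f p x → p ^ vAux f p x ∣ x
  p^vAux∣ zero    p          x       = 1∣ x
  p^vAux∣ (suc f) p          zero    = 1∣ 0
  p^vAux∣ (suc f) zero       (suc n) = 1∣ suc n
  p^vAux∣ (suc f) (suc zero) (suc n) = 1∣ suc n
  p^vAux∣ (suc f) p@(suc (suc q)) (suc n) with p ∣? suc n
  ... | yes p∣ = subst (p * p ^ vAux f p (suc n / p) ∣_) (m*[n/m]≡n p∣)
                   (*-monoʳ-∣ p (p^vAux∣ f p (suc n / p)))
  ... | no  _  = 1∣ _

  p^v∣ : ∀ p x → p ^ v p x ∣ x
  p^v∣ p x = p^vAux∣ x p x

  -- The divisor attached to each factor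

  indicator : ∀ {A : Set} → Dec A → ℕ
  indicator (yes _) = 1
  indicator (no  _) = 0

  module _ (p : ℕ) .{{_ : NonZero p}} where

    multiples : ℕ → ℕ
    multiples zero    = 0
    multiples (suc d) = multiples d + indicator (p ∣? suc d)

    [r+q*p]/p≡q : ∀ {r} q → r < p → (r + q * p) / p ≡ q
    [r+q*p]/p≡q {r} q r<p =
      trans (+-distrib-/ r (q * p) no-carry) (cong₂ _+_ (m<n⇒m/n≡0 r<p) (m*n/n≡m q p))
      where
      no-carry : r % p + (q * p) % p < p
      no-carry = subst (_< p) (sym (cong₂ _+_ (m<n⇒m%n≡m r<p) (m*n%n≡0 q p)))
                   (subst (_< p) (sym (ℕ.+-identityʳ r)) r<p)

    [1+d]/p≡d/p+indicator : ∀ d → suc d / p ≡ d / p + indicator (p ∣? suc d)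
    [1+d]/p≡d/p+indicator d with p ∣? suc d
    ... | yes (divides zero 1+d≡0) = ⊥-elim (ℕ.1+n≢0 1+d≡0)
    ... | yes (divides (suc q) 1+d≡[1+q]p) = begin
      suc d / p      ≡⟨ /-congˡ 1+d≡[1+q]p ⟩
      suc q * p / p  ≡⟨ m*n/n≡m (suc q) p ⟩
      suc q          ≡⟨ ℕ.+-comm 1 q ⟩
      q + 1          ≡⟨ cong (_+ 1) (sym (trans (/-congˡ d≡) ([r+q*p]/p≡q q (ℕ.m≤pred[n]⇒suc[m]≤n ℕ.≤-refl)))) ⟩
      d / p + 1      ∎
      where
      open ≡-Reasoning
      d≡ : d ≡ ℕ.pred p + q * p
      d≡ = ℕ.suc-injective (trans 1+d≡[1+q]p (cong (_+ q * p) (sym (ℕ.suc-pred p))))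
    ... | no p∤1+d with ℕ.m≤n⇒m<n∨m≡n (m%n<n d p)
    ...   | inj₁ 1+r<p = begin
      suc d / p                         ≡⟨ /-congˡ (cong suc (m≡m%n+[m/n]*n d p)) ⟩
      (suc (d % p) + d / p * p) / p     ≡⟨ [r+q*p]/p≡q (d / p) 1+r<p ⟩
      d / p                             ≡⟨ ℕ.+-identityʳ (d / p) ⟨
      d / p + 0                         ∎
      where open ≡-Reasoning
    ...   | inj₂ 1+r≡p = ⊥-elim (p∤1+d (divides (suc (d / p))
              (trans (cong suc (m≡m%n+[m/n]*n d p)) (cong (_+ d / p * p) 1+r≡p))))

    multiples≡/ : ∀ d → multiples d ≡ d / p
    multiples≡/ zero    = sym (0/n≡0 p)
    multiples≡/ (suc d) =
      trans (cong (_+ indicator (p ∣? suc d)) (multiples≡/ d)) (sym ([1+d]/p≡d/p+indicator d))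

  module _ (p : ℕ) .{{_ : NonZero p}} (F X : ℕ) where

    weight : ℕ → ℕ → ℕ
    weight j i with i ≟ j
    ... | yes _ = F
    ... | no  _ = X ^ indicator (p ∣? ∣ i - j ∣)

    weight-≢ : ∀ {i j} → i ≢ j → weight j i ≡ X ^ indicator (p ∣? ∣ i - j ∣)
    weight-≢ {i} {j} i≢j with i ≟ j
    ... | yes i≡j = ⊥-elim (i≢j i≡j)
    ... | no  _   = refl

    weight-diag : ∀ j → weight j j ≡ F
    weight-diag j with j ≟ j
    ... | yes _   = refl
    ... | no  j≢j = ⊥-elim (j≢j refl)

    weight-absorb : ∀ {j n} → n < j → weight j n * X ^ multiples p (j ∸ suc n) ≡ X ^ multiples p (j ∸ n)
    weight-absorb {j} {n} n<j = begin
      weight j n * X ^ multiples p (j ∸ suc n)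
        ≡⟨ cong (_* X ^ multiples p (j ∸ suc n)) (weight-≢ (ℕ.<⇒≢ n<j)) ⟩
      X ^ indicator (p ∣? ∣ n - j ∣) * X ^ multiples p (j ∸ suc n)
        ≡⟨ cong (λ d → X ^ indicator (p ∣? d) * X ^ multiples p (j ∸ suc n))
                (ℕ.m≤n⇒∣m-n∣≡n∸m (ℕ.<⇒≤ n<j)) ⟩
      X ^ indicator (p ∣? (j ∸ n)) * X ^ multiples p (j ∸ suc n)
        ≡⟨ ℕ.*-comm (X ^ indicator (p ∣? (j ∸ n))) _ ⟩
      X ^ multiples p (j ∸ suc n) * X ^ indicator (p ∣? (j ∸ n))
        ≡⟨ ℕ.^-distribˡ-+-* X (multiples p (j ∸ suc n)) _ ⟨
      X ^ (multiples p (j ∸ suc n) + indicator (p ∣? (j ∸ n)))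
        ≡⟨ cong (X ^_) (sym (multiples-step (ℕ.+-∸-assoc 1 n<j))) ⟩
      X ^ multiples p (j ∸ n) ∎
      where
      open ≡-Reasoning
      multiples-step : ∀ {e d} → e ≡ suc d → multiples p e ≡ multiples p d + indicator (p ∣? e)
      multiples-step refl = refl

    ∏≤-weight-below : ∀ {j} n → n < j → ∏≤ n (weight j) * X ^ multiples p (j ∸ suc n) ≡ X ^ multiples p j
    ∏≤-weight-below zero    0<j = weight-absorb 0<j
    ∏≤-weight-below {j} (suc n) n+1<j = begin
      ∏≤ n (weight j) * weight j (suc n) * X ^ multiples p (j ∸ suc (suc n))
        ≡⟨ ℕ.*-assoc (∏≤ n (weight j)) _ _ ⟩
      ∏≤ n (weight j) * (weight j (suc n) * X ^ multiples p (j ∸ suc (suc n)))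
        ≡⟨ cong (∏≤ n (weight j) *_) (weight-absorb n+1<j) ⟩
      ∏≤ n (weight j) * X ^ multiples p (j ∸ suc n)
        ≡⟨ ∏≤-weight-below n (ℕ.<-trans (ℕ.n<1+n n) n+1<j) ⟩
      X ^ multiples p j ∎
      where open ≡-Reasoning

    ∏≤-weight-diag : ∀ j → ∏≤ j (weight j) ≡ F * X ^ multiples p j
    ∏≤-weight-diag zero    = trans (weight-diag 0) (sym (ℕ.*-identityʳ F))
    ∏≤-weight-diag (suc j) = begin
      ∏≤ j (weight (suc j)) * weight (suc j) (suc j)  ≡⟨ cong₂ _*_ below (weight-diag (suc j)) ⟩
      X ^ multiples p (suc j) * F                     ≡⟨ ℕ.*-comm _ F ⟩
      F * X ^ multiples p (suc j)                     ∎
      where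
      open ≡-Reasoning
      below : ∏≤ j (weight (suc j)) ≡ X ^ multiples p (suc j)
      below = trans (sym (ℕ.*-identityʳ _))
                (trans (cong (λ e → ∏≤ j (weight (suc j)) * X ^ multiples p e) (sym (ℕ.n∸n≡0 j)))
                  (∏≤-weight-below j (ℕ.n<1+n j)))

    ∏≤-weight-above : ∀ j r → ∏≤ (r + j) (weight j) ≡ F * X ^ (multiples p j + multiples p r)
    ∏≤-weight-above j zero    =
      trans (∏≤-weight-diag j) (cong (λ e → F * X ^ e) (sym (ℕ.+-identityʳ (multiples p j))))
    ∏≤-weight-above j (suc r) = begin
      ∏≤ (r + j) (weight j) * weight j (suc (r + j))
        ≡⟨ cong₂ _*_ (∏≤-weight-above j r) (weight-≢ (ℕ.>⇒≢ j<1+r+j)) ⟩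
      F * X ^ (multiples p j + multiples p r) * X ^ indicator (p ∣? ∣ suc (r + j) - j ∣)
        ≡⟨ cong (λ d → F * X ^ (multiples p j + multiples p r) * X ^ indicator (p ∣? d)) distance ⟩
      F * X ^ (multiples p j + multiples p r) * X ^ indicator (p ∣? suc r)
        ≡⟨ ℕ.*-assoc F _ _ ⟩
      F * (X ^ (multiples p j + multiples p r) * X ^ indicator (p ∣? suc r))
        ≡⟨ cong (F *_) (sym (ℕ.^-distribˡ-+-* X (multiples p j + multiples p r) (indicator (p ∣? suc r)))) ⟩
      F * X ^ (multiples p j + multiples p r + indicator (p ∣? suc r))
        ≡⟨ cong (λ e → F * X ^ e) (ℕ.+-assoc (multiples p j) _ _) ⟩
      F * X ^ (multiples p j + multiples p (suc r)) ∎
      where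
      open ≡-Reasoning
      j<1+r+j : j < suc (r + j)
      j<1+r+j = s≤s (ℕ.m≤n+m j r)
      distance : ∣ suc (r + j) - j ∣ ≡ suc r
      distance = trans (ℕ.∣-∣-comm (suc (r + j)) j)
                   (trans (ℕ.m≤n⇒∣m-n∣≡n∸m (ℕ.<⇒≤ j<1+r+j)) (ℕ.m+n∸n≡m (suc r) j))

    ∏≤-weight : ∀ {j m} → j ≤ m → ∏≤ m (weight j) ≡ F * X ^ (j / p + (m ∸ j) / p)
    ∏≤-weight {j} {m} j≤m = begin
      ∏≤ m (weight j)
        ≡⟨ cong (λ n → ∏≤ n (weight j)) (ℕ.m∸n+n≡m j≤m) ⟨
      ∏≤ (m ∸ j + j) (weight j)
        ≡⟨ ∏≤-weight-above j (m ∸ j) ⟩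
      F * X ^ (multiples p j + multiples p (m ∸ j))
        ≡⟨ cong₂ (λ a b → F * X ^ (a + b)) (multiples≡/ p j) (multiples≡/ p (m ∸ j)) ⟩
      F * X ^ (j / p + (m ∸ j) / p) ∎
      where open ≡-Reasoning

  ∣+m-+n∣≡∣m-n∣ : ∀ m n → ℤ.∣ + m ℤ.- + n ∣ ≡ ∣ m - n ∣
  ∣+m-+n∣≡∣m-n∣ m n with ℕ.≤-total m n
  ... | inj₁ m≤n =
    trans (cong ℤ.∣_∣ (ℤ.m-n≡m⊖n m n)) (trans (ℤ.∣⊖∣-≤ m≤n) (sym (ℕ.m≤n⇒∣m-n∣≡n∸m m≤n)))
  ... | inj₂ n≤m = begin
    ℤ.∣ + m ℤ.- + n ∣  ≡⟨ cong ℤ.∣_∣ (ℤ.m-n≡m⊖n m n) ⟩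
    ℤ.∣ m ℤ.⊖ n ∣      ≡⟨ ℤ.∣m⊖n∣≡∣n⊖m∣ m n ⟩
    ℤ.∣ n ℤ.⊖ m ∣      ≡⟨ ℤ.∣⊖∣-≤ n≤m ⟩
    m ∸ n              ≡⟨ ℕ.m≤n⇒∣m-n∣≡n∸m n≤m ⟨
    ∣ n - m ∣          ≡⟨ ℕ.∣-∣-comm n m ⟩
    ∣ m - n ∣          ∎
    where open ≡-Reasoning

  prodP-linP-∣! : ∀ {p} .{{_ : NonZero p}} → Prime p → ∀ {m j} → j ≤ m →
                  ∀ F (e : ℕ → ℕ) → (∀ i → F ∣ e i !) →
                  F * p ^ ((j / p + (m ∸ j) / p) * v p F)
                    ∣! prodP m (λ i → powP (linP (+ i ℤ.- + j)) (e i))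
  prodP-linP-∣! {p} p-prime {m} {j} j≤m F e F∣e! =
    subst (_∣! prodP m f) ∏≤weight≡ (∣!-prodP m {weight p F X j} {f} (λ i _ → weight-∣! i))
    where
    V = v p F
    X = p ^ V
    f : ℕ → Poly
    f i = powP (linP (+ i ℤ.- + j)) (e i)

    weight-∣! : ∀ i → weight p F X j i ∣! f i
    weight-∣! i with i ≟ j
    ... | yes refl = subst (λ c → F ∣! powP (linP c) (e i)) (sym (ℤ.+-inverseʳ (+ i)))
                       (∣!-powP-linP-root (e i) (F∣e! i))
    ... | no  _    with p ∣? ∣ i - j ∣
    ...   | no  _   = 1∣!P (f i)
    ...   | yes p∣  = ∣!-weaken {P = f i} (∣-reflexive (ℕ.*-identityʳ X))
                        (∣!-powP-linP-prime p-prime {V} (+ i ℤ.- + j) (e i)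
                          (subst (p ∣_) (sym (∣+m-+n∣≡∣m-n∣ i j)) p∣) (∣-trans (p^v∣ p F) (F∣e! i)))

    ∏≤weight≡ : ∏≤ m (weight p F X j) ≡ F * p ^ ((j / p + (m ∸ j) / p) * V)
    ∏≤weight≡ = trans (∏≤-weight p F X j≤m)
                  (cong (F *_) (trans (ℕ.^-*-assoc p V _) (cong (p ^_) (ℕ.*-comm V (j / p + (m ∸ j) / p)))))

  -- Products of prime powers

  ∣^⇒∣ : ∀ {q} → Prime q → ∀ n a → q ∣ n ^ a → q ∣ n
  ∣^⇒∣ q-prime n zero    q∣1 = ⊥-elim (∤1 q-prime q∣1)
  ∣^⇒∣ q-prime n (suc a) q∣nⁿ with euclidsLemma n (n ^ a) q-prime q∣nⁿ
  ... | inj₁ q∣n  = q∣n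
  ... | inj₂ q∣nᵃ = ∣^⇒∣ q-prime n a q∣nᵃ

  module _ {P : ℕ → Set} (P? : Decidable P) (P⇒prime : ∀ {q} → P q → Prime q) (ν : ℕ → ℕ) where

    primePowerProduct : ℕ → ℕ
    primePowerProduct n = product (map (λ q → q ^ ν q) (filter P? (upTo n)))

    primePowerProduct-suc : ∀ n → P n × primePowerProduct (suc n) ≡ primePowerProduct n * n ^ ν n
                                ⊎ primePowerProduct (suc n) ≡ primePowerProduct n
    primePowerProduct-suc n with P? n | snoc
      where
      snoc : primePowerProduct (suc n)
           ≡ primePowerProduct n * product (map (λ q → q ^ ν q) (filter P? (n ∷ [])))
      snoc = begin
        product (map g (filter P? (upTo (suc n))))
          ≡⟨ cong (λ xs → product (map g (filter P? xs))) (applyUpTo-∷ʳ id n) ⟨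
        product (map g (filter P? (upTo n ++ n ∷ [])))
          ≡⟨ cong (product ∘ map g) (filter-++ P? (upTo n) (n ∷ [])) ⟩
        product (map g (filter P? (upTo n) ++ filter P? (n ∷ [])))
          ≡⟨ cong product (map-++ g (filter P? (upTo n)) _) ⟩
        product (map g (filter P? (upTo n)) ++ map g (filter P? (n ∷ [])))
          ≡⟨ product-++ (map g (filter P? (upTo n))) _ ⟩
        primePowerProduct n * product (map g (filter P? (n ∷ []))) ∎
        where
        open ≡-Reasoning
        g : ℕ → ℕ
        g q = q ^ ν q
    ... | yes Pn | eq = inj₁ (Pn , trans eq (cong (primePowerProduct n *_) (ℕ.*-identityʳ (n ^ ν n))))
    ... | no  _  | eq = inj₂ (trans eq (ℕ.*-identityʳ (primePowerProduct n)))

    primePowerProduct≥1 : ∀ n → 1 ≤ primePowerProduct n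
    primePowerProduct≥1 zero = ℕ.≤-refl
    primePowerProduct≥1 (suc n) with primePowerProduct-suc n
    ... | inj₂ eq        = subst (1 ≤_) (sym eq) (primePowerProduct≥1 n)
    ... | inj₁ (Pn , eq) = subst (1 ≤_) (sym eq) (ℕ.*-mono-≤ (primePowerProduct≥1 n) (ℕ.m^n>0 n (ν n)))
      where instance _ = prime⇒nonZero (P⇒prime Pn)

    ∤primePowerProduct : ∀ {q} → Prime q → ∀ n → n ≤ q → ¬ q ∣ primePowerProduct n
    ∤primePowerProduct q-prime zero    _   = ∤1 q-prime
    ∤primePowerProduct {q} q-prime (suc n) n<q q∣ with primePowerProduct-suc n
    ... | inj₂ eq = ∤primePowerProduct q-prime n (ℕ.<⇒≤ n<q) (subst (q ∣_) eq q∣)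
    ... | inj₁ (Pn , eq) with euclidsLemma (primePowerProduct n) (n ^ ν n) q-prime (subst (q ∣_) eq q∣)
    ...   | inj₁ q∣pp = ∤primePowerProduct q-prime n (ℕ.<⇒≤ n<q) q∣pp
    ...   | inj₂ q∣nᵛ = ℕ.<⇒≱ n<q (∣⇒≤ (∣^⇒∣ q-prime n (ν n) q∣nᵛ))
      where instance _ = prime⇒nonZero (P⇒prime Pn)

    primePowerProduct-∣ : ∀ {Z} → (∀ q → P q → q ^ ν q ∣ Z) → ∀ n → primePowerProduct n ∣ Z
    primePowerProduct-∣ _       zero = 1∣ _
    primePowerProduct-∣ {Z} qᵛ∣Z (suc n) with primePowerProduct-suc n | primePowerProduct-∣ qᵛ∣Z n
    ... | inj₂ eq        | pp∣Z = subst (_∣ Z) (sym eq) pp∣Z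
    ... | inj₁ (Pn , eq) | divides k refl = subst (_∣ k * primePowerProduct n) (sym eq)
        (coprime-part (^∣-cancel-∤ (P⇒prime Pn) (ν n) k
          (∤primePowerProduct (P⇒prime Pn) n ℕ.≤-refl) (qᵛ∣Z n Pn)))
      where
      coprime-part : n ^ ν n ∣ k → primePowerProduct n * n ^ ν n ∣ k * primePowerProduct n
      coprime-part (divides c refl) = divides c (reorder c (n ^ ν n) (primePowerProduct n))
        where
        reorder : ∀ c a b → c * a * b ≡ c * (b * a)
        reorder = ℕ-Ring.solve-∀

    *-primePowerProduct-∣ : ∀ {F Z} .{{_ : NonZero F}} → (∀ q → Prime q → F * q ^ ν q ∣ Z) →
                            ∀ n → F * primePowerProduct n ∣ Z
    *-primePowerProduct-∣ {F} {Z} Fqᵛ∣Z n with ∣-trans (m∣m*n {F} (2 ^ ν 2)) (Fqᵛ∣Z 2 prime[2])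
    ... | divides Z′ refl = subst (F * primePowerProduct n ∣_) (ℕ.*-comm F Z′)
            (*-monoʳ-∣ F (primePowerProduct-∣ qᵛ∣Z′ n))
      where
      qᵛ∣Z′ : ∀ q → P q → q ^ ν q ∣ Z′
      qᵛ∣Z′ q Pq = *-cancelˡ-∣ F (subst (F * q ^ ν q ∣_) (ℕ.*-comm Z′ F) (Fqᵛ∣Z q (P⇒prime Pq)))

  l∸1≤lk : ∀ l k i → l ∸ 1 ≤ lk l k i
  l∸1≤lk l k i = l∸1≤if (does (i ≟ k))
    where
    l∸1≤if : ∀ b → l ∸ 1 ≤ (if b then l ∸ 1 else l)
    l∸1≤if true  = ℕ.≤-refl
    l∸1≤if false = ℕ.m∸n≤m l 1

  σ-∣ : ∀ {m j} l k i → j ≤ m → ∀ q .{{_ : NonZero q}} → Prime q →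
        (l ∸ 1) ! * q ^ ((j / q + (m ∸ j) / q) * v q ((l ∸ 1) !)) ∣ ℤ.∣ + (i !) ℤ.* σ m l k j i ∣
  σ-∣ l k i j≤m q q-prime =
    ℤ.∣⇒∣ᵤ (prodP-linP-∣! q-prime j≤m ((l ∸ 1) !) (lk l k) (λ i → m≤n⇒m!∣n! (l∸1≤lk l k i)) i)

open import Data.Nat as ℕ using (ℕ; _≤_; _!; NonZero; zero; suc; _≤?_)
open import Data.Nat.DivMod using (_/_)
open import Data.Nat.Divisibility as ℕ using ()
open import Data.Nat.Primality using (Prime; prime?)
open import Data.Nat.Properties using (≤-refl; _!≢0)
open import Data.Integer as ℤ using (+_)
open import Data.Integer.Divisibility using (_∣_)
open import Data.Product using (Σ; _×_; _,_; proj₁)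
open import Relation.Binary.PropositionalEquality using (_≡_; refl)
open import Relation.Nullary.Decidable using (_×-dec_)
open import Relation.Unary using (Decidable)

theorem6p2 : (m l j : ℕ) → 1 ≤ m → 1 ≤ l → 1 ≤ j → j ≤ m →
    Σ ℕ λ D → Σ (ℕ → ℕ) λ ν →
      (1 ≤ D)
      × (D ≡ primeProd m ν)
      × ((p : ℕ) → .{{_ : NonZero p}} → Prime p → 2 ℕ.* p ≤ ℕ.suc m →
           (j / p ℕ.+ (m ℕ.∸ j) / p) ℕ.* v p ((l ℕ.∸ 1) !) ≤ ν p)
      × ((k : ℕ) → k ≤ m → (i : ℕ) → i ≤ Lmax m l →
           + ((l ℕ.∸ 1) ! ℕ.* D) ∣ (+ (i !)) ℤ.* σ m l k j i)
theorem6p2 m l j _ _ _ j≤m =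
  primeProd m ν , ν , primePowerProduct≥1 small-prime? proj₁ ν (2 ℕ.+ m) , refl , ν-bound , B*-∣
  where
  small-prime? : Decidable (λ p → Prime p × 2 ℕ.* p ≤ suc m)
  small-prime? p = prime? p ×-dec (2 ℕ.* p ≤? suc m)

  F : ℕ
  F = (l ℕ.∸ 1) !

  ν : ℕ → ℕ
  ν zero      = 0
  ν p@(suc _) = (j / p ℕ.+ (m ℕ.∸ j) / p) ℕ.* v p F

  ν-bound : (p : ℕ) → .{{_ : NonZero p}} → Prime p → 2 ℕ.* p ≤ ℕ.suc m →
            (j / p ℕ.+ (m ℕ.∸ j) / p) ℕ.* v p F ≤ ν p
  ν-bound (suc _) _ _ = ≤-refl

  B*-∣ : (k : ℕ) → k ≤ m → (i : ℕ) → i ≤ Lmax m l →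
         + (F ℕ.* primeProd m ν) ∣ (+ (i !)) ℤ.* σ m l k j i
  B*-∣ k _ i _ = *-primePowerProduct-∣ small-prime? proj₁ ν {{(l ℕ.∸ 1) !≢0}} per-prime (2 ℕ.+ m)
    where
    per-prime : ∀ q → Prime q → F ℕ.* q ℕ.^ ν q ℕ.∣ ℤ.∣ + (i !) ℤ.* σ m l k j i ∣
    per-prime zero    q-prime with 1<p q-prime
    ... | ()
    per-prime (suc q) q-prime = σ-∣ l k i j≤m (suc q) q-prime
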